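{- For all $\beta\in\mathbb{C}\setminus\{0,-1,-2,\ldots\}$ and all integers $q\ge0$ and $s\ge1$, \[ \sum_{m=0}^{q}\binom{q}{m}\frac{(-1)^m}{(\beta+m)^s} =\begin{cases} \dfrac{q!}{(\beta)_{q+1}}\displaystyle\sum_{0\le i_1\le\cdots\le i_{s-1}\le q}\ \prod_{r=1}^{s-1}\frac{1}{\beta+i_r} & \text{if } s\ge2,\\[3mm] \dfrac{q!}{(\beta)_{q+1}} & \text{if } s=1, \end{cases} \] where the sum runs over all integers $i_1,\ldots,i_{s-1}$ with $0\le i_1\le\cdots\le i_{s-1}\le q$.
   Context: $(x)_p$ denotes the Pochhammer symbol $\prod_{j=0}^{p-1}(x+j)$. -}

module Defs where

open import Level using (Level; _⊔_) renaming (suc to lsuc)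
open import Algebra.Bundles using (CommutativeRing)
open import Relation.Nullary using (¬_)
open import Data.Nat as ℕ using (ℕ; zero; suc; _∸_)
open import Data.List using (List; []; _∷_; map; concatMap; upTo; foldr)

-- A field: a commutative ring in which every nonzero element has an inverse.
-- (agda-stdlib 2.3 has no Field bundle.)  No non-triviality axiom is needed here.
record Field (c ℓ : Level) : Set (lsuc (c ⊔ ℓ)) where
  field
    commutativeRing : CommutativeRing c ℓ
  open CommutativeRing commutativeRing public
  field
    inv   : (x : Carrier) → ¬ (x ≈ 0#) → Carrier
    inv-r : (x : Carrier) (p : ¬ (x ≈ 0#)) → x * inv x p ≈ 1#

-- all integers lo, lo+1, ..., q  (empty if q < lo)
range : ℕ → ℕ → List ℕ
range lo q = map (lo ℕ.+_) (upTo (suc q ∸ lo))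

ndSeqs : ℕ → ℕ → ℕ → List (List ℕ)
ndSeqs zero    lo q = [] ∷ []
ndSeqs (suc k) lo q = concatMap (λ i → map (i ∷_) (ndSeqs k i q)) (range lo q)

module FieldOps {c ℓ : Level} (F : Field c ℓ) where
  open Field F

  fromℕ : ℕ → Carrier
  fromℕ zero    = 0#
  fromℕ (suc n) = 1# + fromℕ n

  _^^_ : Carrier → ℕ → Carrier
  x ^^ zero  = 1#
  x ^^ suc n = x * (x ^^ n)

  sumL : List Carrier → Carrier
  sumL = foldr _+_ 0#

  prodL : List Carrier → Carrier
  prodL = foldr _*_ 1#

  module _ (β : Carrier) (β-ok : (n : ℕ) → ¬ (β + fromℕ n ≈ 0#)) where

    recip : ℕ → Carrier
    recip i = inv (β + fromℕ i) (β-ok i)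

    poch : Carrier → ℕ → Carrier
    poch x p = prodL (map (λ j → x + fromℕ j) (upTo p))

    -- 1/(β)_{q+1}, written as ∏_{j=0}^{q} 1/(β+j)
    -- (this avoids needing a nonzeroness proof for the product itself)
    recipPoch : ℕ → Carrier
    recipPoch q = prodL (map recip (upTo (suc q)))

    lhs : ℕ → ℕ → Carrier
    lhs q s = sumL (map (λ m → fromℕ (q ℕC.C m) * ((- 1#) ^^ m) * (recip m ^^ s))
                        (upTo (suc q)))
      where import Data.Nat.Combinatorics as ℕC

    nestedSum : ℕ → ℕ → Carrier
    nestedSum k q = sumL (map (λ is → prodL (map recip is)) (ndSeqs k 0 q))

module Submission where

-- Write L(a,q,s) for the left-hand side with β replaced by β + a. Splitting one factor
-- 1/(β+a+m) by the resolvent identity 1/(β+a) = 1/(β+a+m) + m/((β+a)(β+a+m)) and absorbing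
-- m·C(q+1,m) = (q+1)·C(q,m-1) gives L(a,q+1,s+1) = ((q+1)·L(a+1,q,s+1) + L(a,q+1,s))/(β+a),
-- while L(a,q+1,0) = (1-1)^(q+1) = 0. Splitting off the value i₁ = a, the nested sum over
-- a ≤ i₁ ≤ … ≤ i_s ≤ h obeys the matching recurrence, and (q+1)!/(β+a)_{q+2} = (q+1)/(β+a) ·
-- q!/(β+a+1)_{q+1}, so induction on s and q gives L(a,q,s+1) = q!/(β+a)_{q+1} · (nested sum over [a, a+q]).

open import Defs
open import Level using (Level)
open import Data.Nat using (ℕ; _≥_; _∸_; _!)
open import Relation.Binary.PropositionalEquality using (_≡_)
open import Data.Product using (_×_)
open import Relation.Nullary using (¬_)

open import Algebra.Bundles using (Ring)
open import Data.Fin using (toℕ)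
open import Data.List using (List; []; _∷_; _++_; map; concatMap; upTo; applyUpTo)
open import Data.List.Properties using (map-upTo; map-++; map-∘; map-cong)
open import Data.Nat using (zero; suc; _≤_)
open import Data.Nat.Combinatorics using (_C_; nC1≡n; nCk+nC[k+1]≡[n+1]C[k+1])
open import Data.Product using (_,_)
import Data.Nat as ℕ
import Data.Nat.Properties as ℕₚ
import Relation.Binary.PropositionalEquality as ≡

module _ where
  open Data.Nat using (_+_; _*_)
  open ℕₚ using (*-identityˡ; *-identityʳ; *-zeroʳ)
  open ≡ using (refl; cong; cong₂)
  open import Data.Nat.Solver using (module +-*-Solver)
  open +-*-Solver using (solve; _:+_; _:*_; _:=_; con)
  open ≡.≡-Reasoning

  [k+1]*[n+1]C[k+1]≡[n+1]*nCk : ∀ n k → suc k * (suc n C suc k) ≡ suc n * (n C k)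
  [k+1]*[n+1]C[k+1]≡[n+1]*nCk n       zero    = begin
    1 * (suc n C 1) ≡⟨ *-identityˡ (suc n C 1) ⟩
    suc n C 1       ≡⟨ nC1≡n (suc n) ⟩
    suc n           ≡⟨ *-identityʳ (suc n) ⟨
    suc n * 1       ∎
  [k+1]*[n+1]C[k+1]≡[n+1]*nCk zero    (suc k) = *-zeroʳ (suc (suc k))
  [k+1]*[n+1]C[k+1]≡[n+1]*nCk (suc n) (suc k) = begin
    suc (suc k) * (suc (suc n) C suc (suc k))
      ≡⟨ cong (suc (suc k) *_) (nCk+nC[k+1]≡[n+1]C[k+1] (suc n) (suc k)) ⟨
    suc (suc k) * (a + b)
      ≡⟨ solve 3 (λ k a b → (con 2 :+ k) :* (a :+ b) := (con 1 :+ k) :* a :+ (a :+ (con 2 :+ k) :* b)) refl k a b ⟩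
    suc k * a + (a + suc (suc k) * b)
      ≡⟨ cong₂ (λ u v → u + (a + v)) ([k+1]*[n+1]C[k+1]≡[n+1]*nCk n k) ([k+1]*[n+1]C[k+1]≡[n+1]*nCk n (suc k)) ⟩
    suc n * c + (a + suc n * d)
      ≡⟨ solve 4 (λ n a c d → (con 1 :+ n) :* c :+ (a :+ (con 1 :+ n) :* d) := (con 1 :+ n) :* (c :+ d) :+ a) refl n a c d ⟩
    suc n * (c + d) + a
      ≡⟨ cong (λ u → suc n * u + a) (nCk+nC[k+1]≡[n+1]C[k+1] n k) ⟩
    suc n * a + a
      ≡⟨ solve 2 (λ n a → (con 1 :+ n) :* a :+ a := (con 2 :+ n) :* a) refl n a ⟩
    suc (suc n) * a ∎
    where
      a = suc n C suc k
      b = suc n C suc (suc k)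
      c = n C k
      d = n C suc k

range-cons : ∀ {lo hi} → lo ≤ hi → range lo hi ≡ lo ∷ range (suc lo) hi
range-cons {lo} {hi} lo≤hi = begin
  map (lo ℕ.+_) (upTo (suc hi ∸ lo))            ≡⟨ cong (λ n → map (lo ℕ.+_) (upTo n)) (ℕₚ.+-∸-assoc 1 lo≤hi) ⟩
  lo ℕ.+ 0 ∷ map (lo ℕ.+_) (applyUpTo suc m)    ≡⟨ cong (λ xs → lo ℕ.+ 0 ∷ map (lo ℕ.+_) xs) (map-upTo suc m) ⟨
  lo ℕ.+ 0 ∷ map (lo ℕ.+_) (map suc (upTo m))   ≡⟨ cong (lo ℕ.+ 0 ∷_) (map-∘ (upTo m)) ⟨
  lo ℕ.+ 0 ∷ map (λ i → lo ℕ.+ suc i) (upTo m)  ≡⟨ cong₂ _∷_ (ℕₚ.+-identityʳ lo) (map-cong (ℕₚ.+-suc lo) (upTo m)) ⟩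
  lo ∷ range (suc lo) hi                        ∎
  where
    open ≡
    open ≡-Reasoning
    m = hi ∸ lo

range-suc-self : ∀ n → range (suc n) n ≡ []
range-suc-self n = ≡.cong (λ k → map (suc n ℕ.+_) (upTo k)) (ℕₚ.n∸n≡0 n)

module _ {c ℓ : Level} (R : Ring c ℓ) where
  open Ring R
  open import Algebra.Properties.Semiring.Sum semiring using (sum-cong-≋; sum⁺-syntax)
  open import Algebra.Properties.Semiring.Exp semiring using (_^_; ^-congˡ)
  open import Algebra.Properties.Monoid.Mult +-monoid using (×-congʳ) renaming (_×_ to _·_)
  open import Algebra.Properties.Semiring.Binomial semiring (- 1#) 1# using (binomialExpansion; theorem)
  open import Relation.Binary.Reasoning.Setoid setoid

  1#^n≈1# : ∀ n → 1# ^ n ≈ 1#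
  1#^n≈1# zero    = refl
  1#^n≈1# (suc n) = trans (*-identityˡ (1# ^ n)) (1#^n≈1# n)

  ∑[k≤n+1][n+1]Ck·[-1]^k≈0 : ∀ n → ∑[ k ≤ suc n ] ((suc n C toℕ k) · (- 1#) ^ toℕ k) ≈ 0#
  ∑[k≤n+1][n+1]Ck·[-1]^k≈0 n = begin
    ∑[ k ≤ suc n ] ((suc n C toℕ k) · (- 1#) ^ toℕ k)
      ≈⟨ sum-cong-≋ {suc (suc n)} (λ k → ×-congʳ (suc n C toℕ k) (trans (*-congˡ (1#^n≈1# (suc n ∸ toℕ k))) (*-identityʳ ((- 1#) ^ toℕ k)))) ⟨
    binomialExpansion (suc n)
      ≈⟨ theorem (trans (*-identityʳ (- 1#)) (sym (*-identityˡ (- 1#)))) (suc n) ⟨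
    (- 1# + 1#) ^ suc n   ≈⟨ ^-congˡ (suc n) (-‿inverseˡ 1#) ⟩
    0# * 0# ^ n           ≈⟨ zeroˡ (0# ^ n) ⟩
    0#                    ∎

module _ {c ℓ : Level} (F : Field c ℓ) where
  open Field F
  open FieldOps F
  open import Algebra.Properties.Semiring.Sum semiring using (sum-syntax; sum⁺-syntax; sum-cong-≋; ∑-distrib-+; *-distribˡ-sum)
  open import Algebra.Properties.Semiring.Exp semiring using (_^_)
  open import Algebra.Properties.Semiring.Mult semiring using (×1-homo-*; ×-assoc-*) renaming (_×_ to _·_)
  open import Algebra.Properties.Monoid.Mult +-monoid using (×-homo-+; ×-congʳ)
  open import Algebra.Solver.Ring.NaturalCoefficients.Default commutativeSemiring
  open import Algebra.Properties.Ring ring using (-1*x≈-x)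
  open import Algebra.Properties.CommutativeSemigroup +-commutativeSemigroup using () renaming (x∙yz≈y∙xz to x+[y+z]≈y+[x+z])
  open import Algebra.Properties.CommutativeSemigroup *-commutativeSemigroup using () renaming (x∙yz≈y∙xz to x*[y*z]≈y*[x*z])
  open import Relation.Binary.Reasoning.Setoid setoid

  fromℕ≡n·1# : ∀ n → fromℕ n ≡ n · 1#
  fromℕ≡n·1# zero    = ≡.refl
  fromℕ≡n·1# (suc n) = ≡.cong (1# +_) (fromℕ≡n·1# n)

  fromℕ-homo-+ : ∀ m n → fromℕ (m ℕ.+ n) ≈ fromℕ m + fromℕ n
  fromℕ-homo-+ m n = begin
    fromℕ (m ℕ.+ n)     ≡⟨ fromℕ≡n·1# (m ℕ.+ n) ⟩
    (m ℕ.+ n) · 1#      ≈⟨ ×-homo-+ 1# m n ⟩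
    m · 1# + n · 1#     ≡⟨ ≡.cong₂ _+_ (fromℕ≡n·1# m) (fromℕ≡n·1# n) ⟨
    fromℕ m + fromℕ n   ∎

  fromℕ-homo-* : ∀ m n → fromℕ (m ℕ.* n) ≈ fromℕ m * fromℕ n
  fromℕ-homo-* m n = begin
    fromℕ (m ℕ.* n)     ≡⟨ fromℕ≡n·1# (m ℕ.* n) ⟩
    (m ℕ.* n) · 1#      ≈⟨ ×1-homo-* m n ⟩
    m · 1# * n · 1#     ≡⟨ ≡.cong₂ _*_ (fromℕ≡n·1# m) (fromℕ≡n·1# n) ⟨
    fromℕ m * fromℕ n   ∎

  fromℕ*x≈n·x : ∀ n x → fromℕ n * x ≈ n · x
  fromℕ*x≈n·x n x = begin
    fromℕ n * x      ≡⟨ ≡.cong (_* x) (fromℕ≡n·1# n) ⟩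
    n · 1# * x       ≈⟨ ×-assoc-* n 1# x ⟩
    n · (1# * x)     ≈⟨ ×-congʳ n (*-identityˡ x) ⟩
    n · x            ∎

  x^^n≡x^n : ∀ x n → x ^^ n ≡ x ^ n
  x^^n≡x^n x zero    = ≡.refl
  x^^n≡x^n x (suc n) = ≡.cong (x *_) (x^^n≡x^n x n)

  sumL-applyUpTo : ∀ (f : ℕ → Carrier) n → sumL (applyUpTo f n) ≡ ∑[ i < n ] f (toℕ i)
  sumL-applyUpTo f zero    = ≡.refl
  sumL-applyUpTo f (suc n) = ≡.cong (f 0 +_) (sumL-applyUpTo (λ i → f (suc i)) n)

  sumL-++ : ∀ xs ys → sumL (xs ++ ys) ≈ sumL xs + sumL ys
  sumL-++ []       ys = sym (+-identityˡ (sumL ys))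
  sumL-++ (x ∷ xs) ys = trans (+-congˡ (sumL-++ xs ys)) (sym (+-assoc x (sumL xs) (sumL ys)))

  sumL-map-*ˡ : ∀ {A : Set} x (f : A → Carrier) xs → sumL (map (λ a → x * f a) xs) ≈ x * sumL (map f xs)
  sumL-map-*ˡ x f []       = sym (zeroʳ x)
  sumL-map-*ˡ x f (a ∷ xs) = trans (+-congˡ (sumL-map-*ˡ x f xs)) (sym (distribˡ x (f a) (sumL (map f xs))))

  inv-resolvent : ∀ {x y} d (x≉0 : ¬ x ≈ 0#) (y≉0 : ¬ y ≈ 0#) → y ≈ x + d →
                  inv x x≉0 ≈ inv y y≉0 + d * inv x x≉0 * inv y y≉0
  inv-resolvent {x} {y} d x≉0 y≉0 y≈x+d = begin
    x⁻¹                          ≈⟨ *-identityʳ x⁻¹ ⟨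
    x⁻¹ * 1#                     ≈⟨ *-congˡ (inv-r y y≉0) ⟨
    x⁻¹ * (y * y⁻¹)              ≈⟨ *-congˡ (*-congʳ y≈x+d) ⟩
    x⁻¹ * ((x + d) * y⁻¹)        ≈⟨ solve 4 (λ x d x⁻¹ y⁻¹ → x⁻¹ :* ((x :+ d) :* y⁻¹) := (x :* x⁻¹) :* y⁻¹ :+ d :* x⁻¹ :* y⁻¹) refl x d x⁻¹ y⁻¹ ⟩
    (x * x⁻¹) * y⁻¹ + d * x⁻¹ * y⁻¹ ≈⟨ +-congʳ (trans (*-congʳ (inv-r x x≉0)) (*-identityˡ y⁻¹)) ⟩
    y⁻¹ + d * x⁻¹ * y⁻¹          ∎
    where
      x⁻¹ = inv x x≉0
      y⁻¹ = inv y y≉0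

  module _ (w : ℕ → Carrier) where

    nestedSumBetween : ℕ → ℕ → ℕ → Carrier
    nestedSumBetween k lo hi = sumL (map (λ is → prodL (map w is)) (ndSeqs k lo hi))

    nestedSumBetween-suc : ∀ k lo hi →
      nestedSumBetween (suc k) lo hi ≈ sumL (map (λ i → w i * nestedSumBetween k i hi) (range lo hi))
    nestedSumBetween-suc k lo hi = go (range lo hi)
      where
        φ : List ℕ → Carrier
        φ is = prodL (map w is)
        go : ∀ is → sumL (map φ (concatMap (λ i → map (i ∷_) (ndSeqs k i hi)) is))
                  ≈ sumL (map (λ i → w i * nestedSumBetween k i hi) is)
        go []       = refl
        go (i ∷ is) = begin
          sumL (map φ (map (i ∷_) (ndSeqs k i hi) ++ rest))
            ≡⟨ ≡.cong sumL (map-++ φ (map (i ∷_) (ndSeqs k i hi)) rest) ⟩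
          sumL (map φ (map (i ∷_) (ndSeqs k i hi)) ++ map φ rest)
            ≈⟨ sumL-++ (map φ (map (i ∷_) (ndSeqs k i hi))) (map φ rest) ⟩
          sumL (map φ (map (i ∷_) (ndSeqs k i hi))) + sumL (map φ rest)
            ≡⟨ ≡.cong (λ xs → sumL xs + sumL (map φ rest)) (map-∘ (ndSeqs k i hi)) ⟨
          sumL (map (λ js → w i * φ js) (ndSeqs k i hi)) + sumL (map φ rest)
            ≈⟨ +-cong (sumL-map-*ˡ (w i) φ (ndSeqs k i hi)) (go is) ⟩
          w i * nestedSumBetween k i hi + sumL (map (λ j → w j * nestedSumBetween k j hi) is) ∎
          where rest = concatMap (λ j → map (j ∷_) (ndSeqs k j hi)) is

    nestedSumBetween-cons : ∀ k {lo hi} → lo ≤ hi →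
      nestedSumBetween (suc k) lo hi ≈ w lo * nestedSumBetween k lo hi + nestedSumBetween (suc k) (suc lo) hi
    nestedSumBetween-cons k {lo} {hi} lo≤hi = begin
      nestedSumBetween (suc k) lo hi            ≈⟨ nestedSumBetween-suc k lo hi ⟩
      sumL (map term (range lo hi))             ≡⟨ ≡.cong (λ is → sumL (map term is)) (range-cons lo≤hi) ⟩
      term lo + sumL (map term (range (suc lo) hi)) ≈⟨ +-congˡ (nestedSumBetween-suc k (suc lo) hi) ⟨
      term lo + nestedSumBetween (suc k) (suc lo) hi ∎
      where
        term : ℕ → Carrier
        term i = w i * nestedSumBetween k i hi

    nestedSumBetween-self : ∀ k n → nestedSumBetween k n n ≈ w n ^^ k
    nestedSumBetween-self zero    n = +-identityʳ 1#
    nestedSumBetween-self (suc k) n = begin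
      nestedSumBetween (suc k) n n
        ≈⟨ nestedSumBetween-cons k ℕₚ.≤-refl ⟩
      w n * nestedSumBetween k n n + nestedSumBetween (suc k) (suc n) n
        ≈⟨ +-cong (*-congˡ (nestedSumBetween-self k n)) emptyRange ⟩
      w n * (w n ^^ k) + 0#
        ≈⟨ +-identityʳ (w n ^^ suc k) ⟩
      w n ^^ suc k ∎
      where
        emptyRange : nestedSumBetween (suc k) (suc n) n ≈ 0#
        emptyRange = trans (nestedSumBetween-suc k (suc n) n)
                      (reflexive (≡.cong (λ is → sumL (map (λ i → w i * nestedSumBetween k i n) is)) (range-suc-self n)))

  module _ (β : Carrier) (β-ok : (n : ℕ) → ¬ (β + fromℕ n ≈ 0#)) where

    private
      r : ℕ → Carrier
      r = recip β β-ok

    recip-resolvent : ∀ i k → r i ≈ r (i ℕ.+ k) + fromℕ k * r i * r (i ℕ.+ k)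
    recip-resolvent i k = inv-resolvent (fromℕ k) (β-ok i) (β-ok (i ℕ.+ k))
      (trans (+-congˡ (fromℕ-homo-+ i k)) (sym (+-assoc β (fromℕ i) (fromℕ k))))

    lhsTerm : ℕ → ℕ → ℕ → ℕ → Carrier
    lhsTerm a q s m = fromℕ (q C m) * (- 1#) ^^ m * (r (a ℕ.+ m) ^^ s)

    shiftedLhs : ℕ → ℕ → ℕ → Carrier
    shiftedLhs a q s = ∑[ m ≤ q ] lhsTerm a q s (toℕ m)

    shiftedLhs-zero : ∀ a s → shiftedLhs a 0 s ≈ r a ^^ s
    shiftedLhs-zero a s = begin
      (1# + 0#) * 1# * (r (a ℕ.+ 0) ^^ s) + 0#  ≈⟨ +-identityʳ _ ⟩
      (1# + 0#) * 1# * (r (a ℕ.+ 0) ^^ s)       ≈⟨ *-congʳ (trans (*-identityʳ (1# + 0#)) (+-identityʳ 1#)) ⟩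
      1# * (r (a ℕ.+ 0) ^^ s)                   ≈⟨ *-identityˡ _ ⟩
      r (a ℕ.+ 0) ^^ s                          ≡⟨ ≡.cong (λ i → r i ^^ s) (ℕₚ.+-identityʳ a) ⟩
      r a ^^ s                                  ∎

    shiftedLhs-vanishes : ∀ a q → shiftedLhs a (suc q) 0 ≈ 0#
    shiftedLhs-vanishes a q = trans (sum-cong-≋ {suc (suc q)} term≈) (∑[k≤n+1][n+1]Ck·[-1]^k≈0 ring q)
      where
        term≈ : ∀ m → lhsTerm a (suc q) 0 (toℕ m) ≈ (suc q C toℕ m) · (- 1#) ^ toℕ m
        term≈ m = begin
          fromℕ (suc q C toℕ m) * (- 1#) ^^ toℕ m * 1#  ≈⟨ *-identityʳ _ ⟩
          fromℕ (suc q C toℕ m) * (- 1#) ^^ toℕ m       ≈⟨ fromℕ*x≈n·x (suc q C toℕ m) _ ⟩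
          (suc q C toℕ m) · (- 1#) ^^ toℕ m             ≡⟨ ≡.cong ((suc q C toℕ m) ·_) (x^^n≡x^n (- 1#) (toℕ m)) ⟩
          (suc q C toℕ m) · (- 1#) ^ toℕ m              ∎

    lhsTerm-zero : ∀ a q s → lhsTerm a q (suc s) 0 ≈ r a * lhsTerm a q s 0
    lhsTerm-zero a q s = trans (x*[y*z]≈y*[x*z] (fromℕ (q C 0) * 1#) (r (a ℕ.+ 0)) (r (a ℕ.+ 0) ^^ s))
                               (*-congʳ (reflexive (≡.cong r (ℕₚ.+-identityʳ a))))

    lhsTerm-suc : ∀ a q s m →
      lhsTerm a (suc q) (suc s) (suc m) ≈ r a * (fromℕ (suc q) * lhsTerm (suc a) q (suc s) m + lhsTerm a (suc q) s (suc m))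
    lhsTerm-suc a q s m = sym (begin
      -- after the resolvent identity and absorption the two terms carrying (m+1)/(β+a) cancel
      ρ * (Q * lhsTerm (suc a) q (suc s) m + cc * (ν * σ) * p)
        ≡⟨ ≡.cong (λ i → ρ * (Q * (d * σ * (r i ^^ suc s)) + cc * (ν * σ) * p)) (ℕₚ.+-suc a m) ⟨
      ρ * (Q * (d * σ * (R * p)) + cc * (ν * σ) * p)
        ≈⟨ solve 8 (λ ρ Q d σ R p cc ν → ρ :* (Q :* (d :* σ :* (R :* p)) :+ cc :* (ν :* σ) :* p)
                                      := Q :* d :* (ρ :* σ :* R :* p) :+ ρ :* (cc :* (ν :* σ) :* p)) refl ρ Q d σ R p cc ν ⟩
      Q * d * (ρ * σ * R * p) + ρ * (cc * (ν * σ) * p)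
        ≈⟨ +-cong (*-congʳ absorption) (*-congʳ (recip-resolvent a (suc m))) ⟩
      cc * k * (ρ * σ * R * p) + (R + k * ρ * R) * (cc * (ν * σ) * p)
        ≈⟨ solve 7 (λ ρ k σ R p cc ν → cc :* k :* (ρ :* σ :* R :* p) :+ (R :+ k :* ρ :* R) :* (cc :* (ν :* σ) :* p)
                                        := cc :* (ν :* σ) :* (R :* p) :+ (k :* ρ :* R :* cc :* σ :* p :+ ν :* (k :* ρ :* R :* cc :* σ :* p))) refl ρ k σ R p cc ν ⟩
      cc * (ν * σ) * (R * p) + (W + ν * W)
        ≈⟨ +-congˡ (trans (+-congˡ (-1*x≈-x W)) (-‿inverseʳ W)) ⟩
      cc * (ν * σ) * (R * p) + 0#
        ≈⟨ +-identityʳ _ ⟩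
      lhsTerm a (suc q) (suc s) (suc m) ∎)
      where
        ρ = r a
        Q = fromℕ (suc q)
        d = fromℕ (q C m)
        σ = (- 1#) ^^ m
        ν = - 1#
        R = r (a ℕ.+ suc m)
        p = R ^^ s
        cc = fromℕ (suc q C suc m)
        k = fromℕ (suc m)
        W = k * ρ * R * cc * σ * p
        absorption : Q * d ≈ cc * k
        absorption = begin
          Q * d                              ≈⟨ fromℕ-homo-* (suc q) (q C m) ⟨
          fromℕ (suc q ℕ.* (q C m))          ≡⟨ ≡.cong fromℕ ([k+1]*[n+1]C[k+1]≡[n+1]*nCk q m) ⟨
          fromℕ (suc m ℕ.* (suc q C suc m))  ≈⟨ fromℕ-homo-* (suc m) (suc q C suc m) ⟩
          k * cc                             ≈⟨ *-comm k cc ⟩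
          cc * k                             ∎

    shiftedLhs-suc : ∀ a q s →
      shiftedLhs a (suc q) (suc s) ≈ r a * (fromℕ (suc q) * shiftedLhs (suc a) q (suc s) + shiftedLhs a (suc q) s)
    shiftedLhs-suc a q s = begin
      X 0 + ∑[ m ≤ q ] X (suc (toℕ m))
        ≈⟨ +-cong (lhsTerm-zero a (suc q) s) (sum-cong-≋ {suc q} (λ m → lhsTerm-suc a q s (toℕ m))) ⟩
      r a * t 0 + ∑[ m ≤ q ] (r a * (Q * Z (toℕ m) + t (suc (toℕ m))))
        ≈⟨ +-congˡ (*-distribˡ-sum {suc q} (r a) (λ m → Q * Z (toℕ m) + t (suc (toℕ m)))) ⟨
      r a * t 0 + r a * ∑[ m ≤ q ] (Q * Z (toℕ m) + t (suc (toℕ m)))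
        ≈⟨ distribˡ (r a) (t 0) _ ⟨
      r a * (t 0 + ∑[ m ≤ q ] (Q * Z (toℕ m) + t (suc (toℕ m))))
        ≈⟨ *-congˡ (+-congˡ (∑-distrib-+ {suc q} (λ m → Q * Z (toℕ m)) (λ m → t (suc (toℕ m))))) ⟩
      r a * (t 0 + (∑[ m ≤ q ] (Q * Z (toℕ m)) + ∑[ m ≤ q ] t (suc (toℕ m))))
        ≈⟨ *-congˡ (+-congˡ (+-congʳ (*-distribˡ-sum {suc q} Q (λ m → Z (toℕ m))))) ⟨
      r a * (t 0 + (Q * shiftedLhs (suc a) q (suc s) + ∑[ m ≤ q ] t (suc (toℕ m))))
        ≈⟨ *-congˡ (x+[y+z]≈y+[x+z] (t 0) _ _) ⟩
      r a * (Q * shiftedLhs (suc a) q (suc s) + shiftedLhs a (suc q) s) ∎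
      where
        Q = fromℕ (suc q)
        X = lhsTerm a (suc q) (suc s)
        t = lhsTerm a (suc q) s
        Z = lhsTerm (suc a) q (suc s)

    factorialOverPoch : ℕ → ℕ → Carrier
    factorialOverPoch a zero    = r a
    factorialOverPoch a (suc q) = fromℕ (suc q) * r a * factorialOverPoch (suc a) q

    fromℕ[q!]*∏recip≈factorialOverPoch : ∀ a q →
      fromℕ (q !) * prodL (applyUpTo (λ j → r (a ℕ.+ j)) (suc q)) ≈ factorialOverPoch a q
    fromℕ[q!]*∏recip≈factorialOverPoch a zero = begin
      (1# + 0#) * (r (a ℕ.+ 0) * 1#)  ≈⟨ *-cong (+-identityʳ 1#) (*-identityʳ _) ⟩
      1# * r (a ℕ.+ 0)                ≈⟨ *-identityˡ _ ⟩
      r (a ℕ.+ 0)                     ≡⟨ ≡.cong r (ℕₚ.+-identityʳ a) ⟩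
      r a                             ∎
    fromℕ[q!]*∏recip≈factorialOverPoch a (suc q) = begin
      fromℕ (suc q !) * (r (a ℕ.+ 0) * prodL (applyUpTo (λ j → r (a ℕ.+ suc j)) (suc q)))
        ≡⟨ ≡.cong (λ P → fromℕ (suc q !) * (r (a ℕ.+ 0) * prodL P)) shift ⟩
      fromℕ (suc q !) * (r (a ℕ.+ 0) * Π)
        ≈⟨ *-cong (fromℕ-homo-* (suc q) (q !)) (*-congʳ (reflexive (≡.cong r (ℕₚ.+-identityʳ a)))) ⟩
      Q * fromℕ (q !) * (r a * Π)
        ≈⟨ solve 4 (λ Q F ρ Π → Q :* F :* (ρ :* Π) := Q :* ρ :* (F :* Π)) refl Q (fromℕ (q !)) (r a) Π ⟩
      Q * r a * (fromℕ (q !) * Π)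
        ≈⟨ *-congˡ (fromℕ[q!]*∏recip≈factorialOverPoch (suc a) q) ⟩
      factorialOverPoch a (suc q) ∎
      where
        Q = fromℕ (suc q)
        Π = prodL (applyUpTo (λ j → r (suc a ℕ.+ j)) (suc q))
        shift : applyUpTo (λ j → r (a ℕ.+ suc j)) (suc q) ≡ applyUpTo (λ j → r (suc a ℕ.+ j)) (suc q)
        shift = ≡.trans (≡.sym (map-upTo _ (suc q)))
                        (≡.trans (map-cong (λ j → ≡.cong r (ℕₚ.+-suc a j)) (upTo (suc q))) (map-upTo _ (suc q)))

    shiftedLhs≈factorialOverPoch*nestedSum : ∀ k q a →
      shiftedLhs a q (suc k) ≈ factorialOverPoch a q * nestedSumBetween r k a (a ℕ.+ q)
    shiftedLhs≈factorialOverPoch*nestedSum k zero a = begin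
      shiftedLhs a 0 (suc k)            ≈⟨ shiftedLhs-zero a (suc k) ⟩
      r a * (r a ^^ k)                  ≈⟨ *-congˡ (nestedSumBetween-self r k a) ⟨
      r a * nestedSumBetween r k a a    ≡⟨ ≡.cong (λ hi → r a * nestedSumBetween r k a hi) (ℕₚ.+-identityʳ a) ⟨
      r a * nestedSumBetween r k a (a ℕ.+ 0) ∎
    shiftedLhs≈factorialOverPoch*nestedSum zero (suc q) a = begin
      shiftedLhs a (suc q) 1
        ≈⟨ shiftedLhs-suc a q 0 ⟩
      r a * (Q * shiftedLhs (suc a) q 1 + shiftedLhs a (suc q) 0)
        ≈⟨ *-congˡ (+-cong (*-congˡ (shiftedLhs≈factorialOverPoch*nestedSum 0 q (suc a))) (shiftedLhs-vanishes a q)) ⟩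
      r a * (Q * (f * (1# + 0#)) + 0#)
        ≈⟨ solve 3 (λ ρ Q f → ρ :* (Q :* (f :* (con 1 :+ con 0)) :+ con 0) := Q :* ρ :* f :* (con 1 :+ con 0)) refl (r a) Q f ⟩
      Q * r a * f * (1# + 0#) ∎
      where
        Q = fromℕ (suc q)
        f = factorialOverPoch (suc a) q
    shiftedLhs≈factorialOverPoch*nestedSum (suc k) (suc q) a = begin
      shiftedLhs a (suc q) (suc (suc k))
        ≈⟨ shiftedLhs-suc a q (suc k) ⟩
      r a * (Q * shiftedLhs (suc a) q (suc (suc k)) + shiftedLhs a (suc q) (suc k))
        ≈⟨ *-congˡ (+-cong (*-congˡ (shiftedLhs≈factorialOverPoch*nestedSum (suc k) q (suc a)))
                           (shiftedLhs≈factorialOverPoch*nestedSum k (suc q) a)) ⟩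
      r a * (Q * (f * nestedSumBetween r (suc k) (suc a) (suc a ℕ.+ q)) + Q * r a * f * N₂)
        ≡⟨ ≡.cong (λ hi → r a * (Q * (f * nestedSumBetween r (suc k) (suc a) hi) + Q * r a * f * N₂)) (ℕₚ.+-suc a q) ⟨
      r a * (Q * (f * N₁) + Q * r a * f * N₂)
        ≈⟨ solve 5 (λ ρ Q f N₁ N₂ → ρ :* (Q :* (f :* N₁) :+ Q :* ρ :* f :* N₂) := Q :* ρ :* f :* (ρ :* N₂ :+ N₁)) refl (r a) Q f N₁ N₂ ⟩
      Q * r a * f * (r a * N₂ + N₁)
        ≈⟨ *-congˡ (nestedSumBetween-cons r k (ℕₚ.m≤m+n a (suc q))) ⟨
      factorialOverPoch a (suc q) * nestedSumBetween r (suc k) a (a ℕ.+ suc q) ∎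
      where
        Q = fromℕ (suc q)
        f = factorialOverPoch (suc a) q
        N₁ = nestedSumBetween r (suc k) (suc a) (a ℕ.+ suc q)
        N₂ = nestedSumBetween r k a (a ℕ.+ suc q)

    lhs≈fromℕ[q!]*recipPoch*nestedSum : ∀ q k →
      lhs β β-ok q (suc k) ≈ (fromℕ (q !) * recipPoch β β-ok q) * nestedSum β β-ok k q
    lhs≈fromℕ[q!]*recipPoch*nestedSum q k = begin
      lhs β β-ok q (suc k)
        ≡⟨ ≡.trans (≡.cong sumL (map-upTo (lhsTerm 0 q (suc k)) (suc q))) (sumL-applyUpTo (lhsTerm 0 q (suc k)) (suc q)) ⟩
      shiftedLhs 0 q (suc k)
        ≈⟨ shiftedLhs≈factorialOverPoch*nestedSum k q 0 ⟩
      factorialOverPoch 0 q * nestedSum β β-ok k q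
        ≈⟨ *-congʳ (fromℕ[q!]*∏recip≈factorialOverPoch 0 q) ⟨
      fromℕ (q !) * prodL (applyUpTo r (suc q)) * nestedSum β β-ok k q
        ≡⟨ ≡.cong (λ P → fromℕ (q !) * prodL P * nestedSum β β-ok k q) (map-upTo r (suc q)) ⟨
      (fromℕ (q !) * recipPoch β β-ok q) * nestedSum β β-ok k q ∎

mainTheorem3 : {c ℓ : Level} (F : Field c ℓ) →
    let open Field F in let open FieldOps F in
    (β : Carrier) (β-ok : (n : ℕ) → ¬ (β + fromℕ n ≈ 0#)) (q s : ℕ) → s ≥ 1 →
    (s ≥ 2 → lhs β β-ok q s ≈ (fromℕ (q !) * recipPoch β β-ok q) * nestedSum β β-ok (s ∸ 1) q)
    × (s ≡ 1 → lhs β β-ok q s ≈ fromℕ (q !) * recipPoch β β-ok q)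
mainTheorem3 F β β-ok q (suc k) (ℕ.s≤s ℕ.z≤n) =
    (λ _ → lhs≈fromℕ[q!]*recipPoch*nestedSum F β β-ok q k)
  , λ { ≡.refl → trans (lhs≈fromℕ[q!]*recipPoch*nestedSum F β β-ok q 0) (trans (*-congˡ (+-identityʳ 1#)) (*-identityʳ _)) }
  where open Field F
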